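{- Let $G$ be a finite simple graph such that for any two vertices $x,y\in V(G)$ there exists $S\in\Omega(G)$ with $x,y\in V(G)-S$. Then $G$ is both $\alpha_0^{+}$-stable and $\alpha^{++}$-stable.
   Context: $\alpha(G)$ is the maximum size of a stable set; $\Omega(G)$ is the set of maximum stable sets; $\xi(G)=|\bigcap\{S:S\in\Omega(G)\}|$; $G$ is $\alpha_0^{+}$-stable if $\xi(G)=0$. For $e\in E(\overline{G})$ (a pair of distinct non-adjacent vertices), $G+e$ denotes $G$ with $e$ added. $G$ is $\alpha^{++}$-stable if $\alpha(G+e_1+e_2)=\alpha(G)$ for any $e_1,e_2\in E(\overline{G})$ (not necessarily distinct). -}

module Defs where

open import Data.Nat using (ℕ; _≤_)
open import Data.Fin using (Fin)
open import Data.Fin.Subset using (Subset; _∈_; _∉_; ∣_∣)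
open import Data.Product using (Σ; _×_; _,_; ∃)
open import Data.Sum using (_⊎_)
open import Relation.Binary.PropositionalEquality using (_≡_)
open import Relation.Nullary using (¬_)

record Graph (n : ℕ) : Set₁ where
  field
    Adj   : Fin n → Fin n → Set
    sym   : ∀ {i j} → Adj i j → Adj j i
    irrefl : ∀ i → ¬ Adj i i
open Graph public

Stable : ∀ {n} → Graph n → Subset n → Set
Stable G S = ∀ i j → i ∈ S → j ∈ S → ¬ Adj G i j

IsAlpha : ∀ {n} → Graph n → ℕ → Set
IsAlpha G k = (Σ (Subset _) λ S → Stable G S × ∣ S ∣ ≡ k)
            × (∀ T → Stable G T → ∣ T ∣ ≤ k)

MaxStable : ∀ {n} → Graph n → Subset n → Set
MaxStable G S = Stable G S × (∀ T → Stable G T → ∣ T ∣ ≤ ∣ S ∣)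

-- ξ(G) = 0 : the intersection of all maximum stable sets is empty.
Alpha0PlusStable : ∀ {n} → Graph n → Set
Alpha0PlusStable {n} G = ∀ (v : Fin n) → ∃ λ S → MaxStable G S × v ∉ S

NonEdge : ∀ {n} → Graph n → Fin n → Fin n → Set
NonEdge G u v = ¬ (u ≡ v) × ¬ Adj G u v

addEdge : ∀ {n} → Graph n → (u v : Fin n) → ¬ (u ≡ v) → Graph n
addEdge {n} G u v u≢v = record
  { Adj = A
  ; sym = s
  ; irrefl = ir
  }
  where
  A : Fin n → Fin n → Set
  A i j = Adj G i j ⊎ ((i ≡ u × j ≡ v) ⊎ (i ≡ v × j ≡ u))
  open import Data.Sum using (inj₁; inj₂)
  s : ∀ {i j} → A i j → A j i
  s (inj₁ a) = inj₁ (Graph.sym G a)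
  s (inj₂ (inj₁ (p , q))) = inj₂ (inj₂ (q , p))
  s (inj₂ (inj₂ (p , q))) = inj₂ (inj₁ (q , p))
  open import Relation.Binary.PropositionalEquality using (refl)
  ir : ∀ i → ¬ A i i
  ir i (inj₁ a) = Graph.irrefl G i a
  ir i (inj₂ (inj₁ (refl , refl))) = u≢v refl
  ir i (inj₂ (inj₂ (refl , refl))) = u≢v refl

AlphaPlusPlusStable : ∀ {n} → Graph n → Set
AlphaPlusPlusStable {n} G =
  ∀ (u₁ v₁ u₂ v₂ : Fin n) (e₁ : NonEdge G u₁ v₁) (e₂ : NonEdge G u₂ v₂) (k : ℕ) →
  IsAlpha G k →
  IsAlpha (addEdge (addEdge G u₁ v₁ (Data.Product.proj₁ e₁)) u₂ v₂ (Data.Product.proj₁ e₂)) k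
  where import Data.Product

{-# OPTIONS --safe #-}
-- Adding edges can only destroy stable sets, so α(G + e₁ + e₂) ≤ α(G). Conversely, for
-- e₁ = u₁v₁ and e₂ = u₂v₂ take a maximum stable set S of G avoiding u₁ and u₂: each new
-- edge has an endpoint outside S, so S stays stable in G + e₁ + e₂. Taking x = y = v gives ξ(G) = 0.
module Submission where

open import Defs
open import Data.Nat using (ℕ; _≤_)
open import Data.Nat.Properties using (≤-antisym)
open import Data.Fin using (Fin)
open import Data.Fin.Subset using (Subset; _∉_; ∣_∣)
open import Data.Product using (_×_; ∃; _,_; proj₁)
open import Data.Sum using (inj₁; inj₂)
open import Relation.Binary.PropositionalEquality using (_≡_; refl; subst)
open import Relation.Nullary using (¬_)

private
  variable
    n : ℕ
    u v : Fin n

Stable-addEdge⁻ : ∀ (G : Graph n) (u≢v : ¬ u ≡ v) {S : Subset n} →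
                  Stable (addEdge G u v u≢v) S → Stable G S
Stable-addEdge⁻ G u≢v stable i j i∈S j∈S adj = stable i j i∈S j∈S (inj₁ adj)

Stable-addEdge⁺ : ∀ (G : Graph n) (u≢v : ¬ u ≡ v) {S : Subset n} →
                  Stable G S → u ∉ S → Stable (addEdge G u v u≢v) S
Stable-addEdge⁺ G u≢v stable u∉S i j i∈S j∈S (inj₁ adj)                 = stable i j i∈S j∈S adj
Stable-addEdge⁺ G u≢v stable u∉S i j i∈S j∈S (inj₂ (inj₁ (refl , _))) = u∉S i∈S
Stable-addEdge⁺ G u≢v stable u∉S i j i∈S j∈S (inj₂ (inj₂ (_ , refl))) = u∉S j∈S

MaxStable-size≡α : ∀ (G : Graph n) {k : ℕ} {S : Subset n} →
                 IsAlpha G k → MaxStable G S → ∣ S ∣ ≡ k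
MaxStable-size≡α G {S = S} ((S₀ , stable₀ , ∣S₀∣≡k) , bound) (stable , maximum) =
  ≤-antisym (bound _ stable) (subst (_≤ ∣ S ∣) ∣S₀∣≡k (maximum S₀ stable₀))

IsAlpha-supergraph : ∀ (G H : Graph n) {k : ℕ} {S : Subset n} →
                     (∀ {T} → Stable H T → Stable G T) →
                     MaxStable G S → Stable H S →
                     IsAlpha G k → IsAlpha H k
IsAlpha-supergraph G H {S = S} H⊆G maxS stableᴴ αG@(_ , bound) =
  (S , stableᴴ , MaxStable-size≡α G αG maxS) , λ T stable → bound T (H⊆G stable)

lemma1 : ∀ (n : ℕ) (G : Graph n) →
    (∀ (x y : Fin n) → ∃ λ S → MaxStable G S × (x ∉ S × y ∉ S)) →
    Alpha0PlusStable G × AlphaPlusPlusStable G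
lemma1 n G avoiding = α₀⁺ , α⁺⁺
  where
  α₀⁺ : Alpha0PlusStable G
  α₀⁺ v with avoiding v v
  ... | S , maxS , v∉S , _ = S , maxS , v∉S

  α⁺⁺ : AlphaPlusPlusStable G
  α⁺⁺ u₁ v₁ u₂ v₂ (u₁≢v₁ , _) (u₂≢v₂ , _) k with avoiding u₁ u₂
  ... | S , maxS , u₁∉S , u₂∉S =
    IsAlpha-supergraph G (addEdge G₁ u₂ v₂ u₂≢v₂)
      (λ stable → Stable-addEdge⁻ G u₁≢v₁ (Stable-addEdge⁻ G₁ u₂≢v₂ stable))
      maxS
      (Stable-addEdge⁺ G₁ u₂≢v₂ (Stable-addEdge⁺ G u₁≢v₁ (proj₁ maxS) u₁∉S) u₂∉S)
    where
    G₁ : Graph n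
    G₁ = addEdge G u₁ v₁ u₁≢v₁
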